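{- In the category whose objects are linear orders and whose morphisms are strictly order-preserving maps, no pair of non-empty objects has a coproduct. -}

module Defs where

open import Level using (Level; _⊔_; suc)
open import Data.Product using (Σ; _×_)
open import Relation.Binary.Bundles using (StrictTotalOrder)

-- Objects of the category: linear orders, rendered as stdlib strict total
-- orders (a carrier with a setoid equality _≈_ and a strict, trichotomous _<_),
-- all at fixed universe levels a, ℓ₁, ℓ₂.

module _ {a ℓ₁ ℓ₂ : Level} where

  record Hom (A B : StrictTotalOrder a ℓ₁ ℓ₂) : Set (a ⊔ ℓ₁ ⊔ ℓ₂) where
    private
      module A = StrictTotalOrder A
      module B = StrictTotalOrder B
    field
      fun  : A.Carrier → B.Carrier
      cong : ∀ {x y} → x A.≈ y → fun x B.≈ fun y
      mono : ∀ {x y} → x A.< y → fun x B.< fun y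
  open Hom public

  _≗ₕ_ : {A B : StrictTotalOrder a ℓ₁ ℓ₂} → Hom A B → Hom A B → Set (a ⊔ ℓ₁)
  _≗ₕ_ {A} {B} f g = ∀ (x : StrictTotalOrder.Carrier A) →
    StrictTotalOrder._≈_ B (fun f x) (fun g x)

  _∘ₕ_ : {A B C : StrictTotalOrder a ℓ₁ ℓ₂} → Hom B C → Hom A B → Hom A C
  fun  (g ∘ₕ f) x = fun g (fun f x)
  cong (g ∘ₕ f) p = cong g (cong f p)
  mono (g ∘ₕ f) p = mono g (mono f p)

  IsCoproduct : (A B C : StrictTotalOrder a ℓ₁ ℓ₂) → Hom A C → Hom B C
              → Set (suc (a ⊔ ℓ₁ ⊔ ℓ₂))
  IsCoproduct A B C i₁ i₂ =
    ∀ (D : StrictTotalOrder a ℓ₁ ℓ₂) (f : Hom A D) (g : Hom B D) →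
    Σ (Hom C D) λ h →
      ((h ∘ₕ i₁) ≗ₕ f × (h ∘ₕ i₂) ≗ₕ g)
      × (∀ (h′ : Hom C D) → (h′ ∘ₕ i₁) ≗ₕ f → (h′ ∘ₕ i₂) ≗ₕ g → h′ ≗ₕ h)

{-# OPTIONS --safe #-}

-- If (C, i₁, i₂) were a coproduct of A ∋ x and B ∋ y, the mediating map into
-- any cocone would carry the position of i₁ x relative to i₂ y in C over to the
-- images of x and y, because strictly monotone maps between linear orders
-- reflect the order.  The ordinal sum A ⊕ B is a cocone placing x before y, so
-- i₁ x < i₂ y; as (C, i₂, i₁) is a coproduct of B and A, also i₂ y < i₁ x.

module Submission where

open import Defs
open import Level using (Level; Lift; lift)
open import Data.Empty using (⊥)
open import Data.Product using (_,_)
open import Data.Sum.Base using (_⊎_; inj₁; inj₂)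
open import Data.Unit using (⊤; tt)
open import Relation.Nullary using (¬_; contradiction)
open import Relation.Binary.Core using (Rel)
open import Relation.Binary.Bundles using (StrictTotalOrder)
open import Relation.Binary.Definitions
  using (Reflexive; Symmetric; Transitive; Trichotomous; tri<; tri≈; tri>)
open import Relation.Binary.Structures.Biased using (isStrictTotalOrderᶜ)

module _ {a ℓ₁ ℓ₂ : Level} {A B : StrictTotalOrder a ℓ₁ ℓ₂} where
  private
    module A = StrictTotalOrder A
    module B = StrictTotalOrder B

  Hom-reflects-< : (h : Hom A B) → ∀ {x y} → fun h x B.< fun h y → x A.< y
  Hom-reflects-< h {x} {y} hx<hy with A.compare x y
  ... | tri< x<y _ _ = x<y
  ... | tri≈ _ x≈y _ = contradiction hx<hy (B.irrefl (cong h x≈y))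
  ... | tri> _ _ y<x = contradiction hx<hy (B.asym (mono h y<x))

  Hom-reflects-<-up-to-≈ : (h : Hom A B) → ∀ {x y u v} →
                           fun h x B.≈ u → fun h y B.≈ v → u B.< v → x A.< y
  Hom-reflects-<-up-to-≈ h hx≈u hy≈v u<v =
    Hom-reflects-< h (B.<-respˡ-≈ (B.Eq.sym hx≈u) (B.<-respʳ-≈ (B.Eq.sym hy≈v) u<v))

module OrdinalSum {a ℓ₁ ℓ₂ : Level} (X Y : StrictTotalOrder a ℓ₁ ℓ₂) where
  private
    module X = StrictTotalOrder X
    module Y = StrictTotalOrder Y

  Carrier : Set a
  Carrier = X.Carrier ⊎ Y.Carrier

  infix 4 _≈_ _<_

  -- Defined by recursion rather than as inductive families, which would be too
  -- large: their sort would have to include the level a of the carriers.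
  _≈_ : Rel Carrier ℓ₁
  inj₁ x ≈ inj₁ x′ = x X.≈ x′
  inj₂ y ≈ inj₂ y′ = y Y.≈ y′
  _      ≈ _       = Lift ℓ₁ ⊥

  _<_ : Rel Carrier ℓ₂
  inj₁ x < inj₁ x′ = x X.< x′
  inj₁ _ < inj₂ _  = Lift ℓ₂ ⊤
  inj₂ _ < inj₁ _  = Lift ℓ₂ ⊥
  inj₂ y < inj₂ y′ = y Y.< y′

  ≈-refl : Reflexive _≈_
  ≈-refl {inj₁ _} = X.Eq.refl
  ≈-refl {inj₂ _} = Y.Eq.refl

  ≈-sym : Symmetric _≈_
  ≈-sym {inj₁ _} {inj₁ _} = X.Eq.sym
  ≈-sym {inj₂ _} {inj₂ _} = Y.Eq.sym

  ≈-trans : Transitive _≈_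
  ≈-trans {inj₁ _} {inj₁ _} {inj₁ _} = X.Eq.trans
  ≈-trans {inj₂ _} {inj₂ _} {inj₂ _} = Y.Eq.trans

  <-trans : Transitive _<_
  <-trans {inj₁ _} {inj₁ _} {inj₁ _} = X.trans
  <-trans {inj₁ _} {inj₁ _} {inj₂ _} _ _ = lift tt
  <-trans {inj₁ _} {inj₂ _} {inj₂ _} _ _ = lift tt
  <-trans {inj₂ _} {inj₂ _} {inj₂ _} = Y.trans

  <-cmp : Trichotomous _≈_ _<_
  <-cmp (inj₁ x) (inj₁ x′) = X.compare x x′
  <-cmp (inj₁ _) (inj₂ _)  = tri< (lift tt) (λ ()) (λ ())
  <-cmp (inj₂ _) (inj₁ _)  = tri> (λ ()) (λ ()) (lift tt)
  <-cmp (inj₂ y) (inj₂ y′) = Y.compare y y′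

  _⊕_ : StrictTotalOrder a ℓ₁ ℓ₂
  _⊕_ = record
    { isStrictTotalOrder = isStrictTotalOrderᶜ record
      { isEquivalence = record
        { refl  = λ {u} → ≈-refl {u}
        ; sym   = λ {u v} → ≈-sym {u} {v}
        ; trans = λ {u v w} → ≈-trans {u} {v} {w}
        }
      ; trans   = λ {u v w} → <-trans {u} {v} {w}
      ; compare = <-cmp
      }
    }

  ⊕-inj₁ : Hom X _⊕_
  ⊕-inj₁ = record { fun = inj₁ ; cong = λ x≈x′ → x≈x′ ; mono = λ x<x′ → x<x′ }

  ⊕-inj₂ : Hom Y _⊕_
  ⊕-inj₂ = record { fun = inj₂ ; cong = λ y≈y′ → y≈y′ ; mono = λ y<y′ → y<y′ }

  ⊕-inj₁<inj₂ : ∀ x y → inj₁ x < inj₂ y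
  ⊕-inj₁<inj₂ _ _ = lift tt

open OrdinalSum using (_⊕_; ⊕-inj₁; ⊕-inj₂; ⊕-inj₁<inj₂)

module _ {a ℓ₁ ℓ₂ : Level} {A B C : StrictTotalOrder a ℓ₁ ℓ₂}
         (i₁ : Hom A C) (i₂ : Hom B C) where

  IsCoproduct-swap : IsCoproduct A B C i₁ i₂ → IsCoproduct B A C i₂ i₁
  IsCoproduct-swap isCoproduct D f g with isCoproduct D g f
  ... | h , (h∘i₁≗g , h∘i₂≗f) , unique = h , (h∘i₂≗f , h∘i₁≗g) , λ h′ p q → unique h′ q p

  IsCoproduct⇒i₁<i₂ : IsCoproduct A B C i₁ i₂ →
                      ∀ x y → StrictTotalOrder._<_ C (fun i₁ x) (fun i₂ y)
  IsCoproduct⇒i₁<i₂ isCoproduct x y with isCoproduct (A ⊕ B) (⊕-inj₁ A B) (⊕-inj₂ A B)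
  ... | h , (h∘i₁≗inj₁ , h∘i₂≗inj₂) , _ =
    Hom-reflects-<-up-to-≈ h (h∘i₁≗inj₁ x) (h∘i₂≗inj₂ y) (⊕-inj₁<inj₂ A B x y)

mainTheorem18 : ∀ {a ℓ₁ ℓ₂ : Level} (A B : StrictTotalOrder a ℓ₁ ℓ₂) →
                  StrictTotalOrder.Carrier A → StrictTotalOrder.Carrier B →
                  ∀ (C : StrictTotalOrder a ℓ₁ ℓ₂) (i₁ : Hom A C) (i₂ : Hom B C) →
                  ¬ IsCoproduct A B C i₁ i₂
mainTheorem18 A B x y C i₁ i₂ isCoproduct =
  StrictTotalOrder.asym C (IsCoproduct⇒i₁<i₂ i₁ i₂ isCoproduct x y)
                          (IsCoproduct⇒i₁<i₂ i₂ i₁ (IsCoproduct-swap i₁ i₂ isCoproduct) y x)
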